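{- Let $m\ge 4$ and let $n\ge 5$ be odd, and let $t$ be an integer with $2\le t\le \frac{n-1}{2}$. Let $G''(t)$ be the subgraph of $G_{m,n}=S_m\Box P_n$ induced by $V(S_m)\times\{t,\,t+\tfrac{n-1}{2}\}$ (the two star copies $S_{m(t)}$ and $S_{m(t+\frac{n-1}{2})}$). Then the radio number of $G''(t)$ in $G_{m,n}$ satisfies $$rn(G''(t))\ge mn+m-\tfrac{1}{2}(n-3).$$
   Context: $S_m$ is the star on $m$ vertices with center $c$ and leaves; $P_n$ is the path with vertices $1,\dots,n$. $G_{m,n}=S_m\Box P_n$ has vertex set $V(S_m)\times\{1,\dots,n\}$, with $(a,i)\sim(b,j)$ iff ($a=b$ and $|i-j|=1$) or ($i=j$ and $ab\in E(S_m)$). Its distance is $d((a,i),(b,j))=d_{S_m}(a,b)+|i-j|$ and its diameter is $n+1$. For a subset $H$ of vertices (or induced subgraph) of $G_{m,n}$, a radio labeling of $H$ in $G_{m,n}$ is a function $f:V(H)\to\mathbb{Z}_{\ge 0}$ with $|f(u)-f(v)|\ge \mathrm{diam}(G_{m,n})+1-d_{G_{m,n}}(u,v)$ for all distinct $u,v\in V(H)$ (distances and diameter taken in $G_{m,n}$); its span is $\max f-\min f$, and $rn(H)$ is the minimum span over all such labelings. -}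

module Defs where

open import Data.Nat using (ℕ; zero; suc; _+_; _*_; _∸_; _≤_; _⊔_; _⊓_; ∣_-_∣)
open import Data.Fin using (Fin)
open import Data.Fin.Properties using (_≟_)
open import Data.Product using (_×_; _,_)
open import Data.List using (List; []; _∷_; map; foldr; _++_; allFin)
open import Data.List.Membership.Propositional using (_∈_)
open import Relation.Binary.PropositionalEquality using (_≡_)
open import Relation.Nullary using (¬_; yes; no)
open import Data.Bool using (Bool; true; false; if_then_else_; _∨_)

-- Star S_m on vertex set Fin m: center is the vertex whose index is 0 (m ≥ 1),
-- the other m-1 vertices are leaves.
isCenter : ∀ {m} → Fin m → Bool
isCenter Fin.zero = true
isCenter (Fin.suc _) = false

dStar : ∀ {m} → Fin m → Fin m → ℕ
dStar a b with a ≟ b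
... | yes _ = 0
... | no _ = if isCenter a ∨ isCenter b then 1 else 2

-- vertices of G_{m,n} = S_m □ P_n : (star vertex, path index i with 1 ≤ i ≤ n)
Vtx : ℕ → Set
Vtx m = Fin m × ℕ

dist : ∀ {m} → Vtx m → Vtx m → ℕ
dist (a , i) (b , j) = dStar a b + ∣ i - j ∣

diam : ℕ → ℕ
diam n = n + 1

-- f (restricted to the vertex list H) is a radio labeling of H in G_{m,n}:
-- |f u - f v| ≥ diam + 1 - d(u,v)  (stated without truncated subtraction)
IsRadioLabeling : (m n : ℕ) → List (Vtx m) → (Vtx m → ℕ) → Set
IsRadioLabeling m n H f =
  ∀ u v → u ∈ H → v ∈ H → ¬ (u ≡ v) → diam n + 1 ≤ dist u v + ∣ f u - f v ∣

maxL : List ℕ → ℕ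
maxL = foldr _⊔_ 0

minL : List ℕ → ℕ
minL [] = 0
minL (x ∷ xs) = foldr _⊓_ x xs

span : ∀ {m} → List (Vtx m) → (Vtx m → ℕ) → ℕ
span H f = maxL (map f H) ∸ minL (map f H)

rnAtLeast : (m n : ℕ) → List (Vtx m) → ℕ → Set
rnAtLeast m n H K = ∀ (f : Vtx m → ℕ) → IsRadioLabeling m n H f → K ≤ span H f

starCopy : (m i : ℕ) → List (Vtx m)
starCopy m i = map (λ a → (a , i)) (allFin m)

G'' : (m n t : ℕ) → List (Vtx m)
G'' m n t = starCopy m t ++ starCopy m (t + (n ∸ 1) Data.Nat./ 2)

-- Sort the 2m vertices of G''(t) by label. Two vertices of the two star copies are at distance
-- at most (n-1)/2 + 2, and at most (n-1)/2 + 1 when one of them is a centre, at most (n-1)/2 when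
-- both are. So consecutive labels differ by at least (n+1)/2 plus the number of centres among the
-- two vertices. Summing the 2m-1 gaps, each of the two centres is counted twice unless it is the
-- first or the last vertex, which gives span ≥ (2m-1)(n+1)/2 + 2 = mn + m - (n-3)/2.
module Submission where

open import Defs
open import Data.Bool using (true; false; _∨_; if_then_else_)
open import Data.Fin using (Fin; zero; suc)
open import Data.Fin.Properties using () renaming (_≟_ to _≟ᶠ_)
open import Data.Nat
open import Data.Nat.Properties
open import Data.Nat.DivMod using (m≡m%n+[m/n]*n; m*n/n≡m; [m∸n]/n≡m/n∸1)
open import Data.Nat.ListAction using (sum)
open import Data.Nat.ListAction.Properties using (sum-++; sum-↭)
open import Data.Nat.Tactic.RingSolver using (solve-∀)
open import Data.Product using (∃-syntax; _×_; _,_; proj₁; proj₂)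
open import Data.Sum as Sum using (_⊎_; inj₁; inj₂)
open import Data.List using (List; []; _∷_; map; foldr; length; tabulate; allFin; _++_)
open import Data.List.Properties using (map-∘; map-++; map-tabulate; length-++; length-map; length-tabulate)
open import Data.List.Membership.Propositional using (_∈_)
open import Data.List.Membership.Propositional.Properties using (∈-map⁻; ∈-map⁺; ∈-++⁻)
open import Data.List.Relation.Unary.Any using (here; there)
open import Data.List.Relation.Unary.All as All using (All; _∷_)
open import Data.List.Relation.Unary.AllPairs using (_∷_)
open import Data.List.Relation.Unary.Linked using (Linked; []; [-]; _∷_)
open import Data.List.Relation.Unary.Unique.Propositional using (Unique)
import Data.List.Relation.Unary.Unique.Propositional.Properties as Unique
open import Data.List.Relation.Binary.Permutation.Propositional using (_↭_; ↭-sym; ↭⇒↭ₛ)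
open import Data.List.Relation.Binary.Permutation.Propositional.Properties
  using (∈-resp-↭; ↭-length) renaming (map⁺ to ↭-map⁺)
import Data.List.Relation.Binary.Permutation.Setoid.Properties as Permutationₛ
import Data.List.Sort as Sort
import Relation.Binary.Construct.On as On
open import Relation.Binary.PropositionalEquality
open import Relation.Nullary using (¬_; yes; no)
open import Function using (_∘_; id)

maxL-≥ : ∀ {x xs} → x ∈ xs → x ≤ maxL xs
maxL-≥ {xs = y ∷ xs} (here refl) = m≤m⊔n y _
maxL-≥ {xs = y ∷ xs} (there p)   = ≤-trans (maxL-≥ p) (m≤n⊔m y _)

foldr-⊓-≤ : ∀ x xs {y} → y ∈ x ∷ xs → foldr _⊓_ x xs ≤ y
foldr-⊓-≤ x []       (here refl)         = ≤-refl
foldr-⊓-≤ x (z ∷ zs) (here refl)         = ≤-trans (m⊓n≤n z _) (foldr-⊓-≤ x zs (here refl))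
foldr-⊓-≤ x (z ∷ zs) (there (here refl)) = m⊓n≤m z _
foldr-⊓-≤ x (z ∷ zs) (there (there p))   = ≤-trans (m⊓n≤n z _) (foldr-⊓-≤ x zs (there p))

minL-≤ : ∀ {x xs} → x ∈ xs → minL xs ≤ x
minL-≤ {xs = y ∷ ys} = foldr-⊓-≤ y ys

module _ {A : Set} (f w : A → ℕ) (g : ℕ) where

  Gap : A → A → Set
  Gap u v = f u + (g + w u + w v) ≤ f v

  gap-chain-bound : ∀ a r → Linked Gap (a ∷ r) →
    ∃[ z ] z ∈ a ∷ r × f a + (length r * g + 2 * sum (map w (a ∷ r))) ≤ f z + w a + w z
  gap-chain-bound a [] _ = a , here refl , ≤-reflexive (arith (f a) (w a))
    where
    arith : ∀ x y → x + (0 * g + 2 * (y + 0)) ≡ x + y + y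
    arith = solve-∀
  gap-chain-bound a (b ∷ r) (a⟶b ∷ gaps) with gap-chain-bound b r gaps
  ... | z , z∈ , bound = z , there z∈ , +-cancelʳ-≤ (w b) _ _ (begin
      f a + (suc (length r) * g + 2 * (w a + sum (map w (b ∷ r)))) + w b
        ≡⟨ arith₁ (f a) g (w a) (w b) (length r * g) (sum (map w (b ∷ r))) ⟩
      f a + (g + w a + w b) + (length r * g + 2 * sum (map w (b ∷ r))) + w a
        ≤⟨ +-monoˡ-≤ (w a) (+-monoˡ-≤ _ a⟶b) ⟩
      f b + (length r * g + 2 * sum (map w (b ∷ r))) + w a
        ≤⟨ +-monoˡ-≤ (w a) bound ⟩
      f z + w b + w z + w a
        ≡⟨ arith₂ (f z) (w a) (w b) (w z) ⟩
      f z + w a + w z + w b ∎)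
    where
    open ≤-Reasoning
    arith₁ : ∀ x h y u l s → x + ((h + l) + 2 * (y + s)) + u ≡ x + (h + y + u) + (l + 2 * s) + y
    arith₁ = solve-∀
    arith₂ : ∀ x y u v → x + u + v + y ≡ x + y + v + u
    arith₂ = solve-∀

  module _ {xs : List A}
           (separated : ∀ {u v} → u ∈ xs → v ∈ xs → u ≢ v → g + w u + w v ≤ ∣ f u - f v ∣) where

    sorted⇒gaps : ∀ {ys} → Linked (λ u v → f u ≤ f v) ys → Unique ys → All (_∈ xs) ys → Linked Gap ys
    sorted⇒gaps []      _ _ = []
    sorted⇒gaps [-]     _ _ = [-]
    sorted⇒gaps {u ∷ v ∷ _} (fu≤fv ∷ sorted) ((u≢v ∷ _) ∷ distinct) (u∈ ∷ v∈ ∷ inside) =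
      gap ∷ sorted⇒gaps sorted distinct (v∈ ∷ inside)
      where
      gap : Gap u v
      gap = ≤-trans (+-monoʳ-≤ _ (subst (_ ≤_) (m≤n⇒∣m-n∣≡n∸m fu≤fv) (separated u∈ v∈ u≢v)))
                    (≤-reflexive (m+[n∸m]≡n fu≤fv))

    span-lower-bound : (∀ x → w x ≤ 1) → Unique xs →
      (length xs ∸ 1) * g + 2 * sum (map w xs) ≤ maxL (map f xs) ∸ minL (map f xs) + 2
    span-lower-bound w≤1 unique = begin
      (length xs ∸ 1) * g + 2 * sum (map w xs)
        ≡⟨ cong₂ (λ l s → (l ∸ 1) * g + 2 * s) (↭-length (sort-↭ xs)) (sum-↭ (↭-map⁺ w (sort-↭ xs))) ⟨
      (length (sort xs) ∸ 1) * g + 2 * sum (map w (sort xs))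
        ≤⟨ bound (sort xs) (sort-↭ xs) (sort-↗ xs) ⟩
      maxL (map f xs) ∸ minL (map f xs) + 2 ∎
      where
      open ≤-Reasoning
      open Sort (On.decTotalOrder ≤-decTotalOrder f)
      bound : ∀ ys → ys ↭ xs → Linked (λ u v → f u ≤ f v) ys →
        (length ys ∸ 1) * g + 2 * sum (map w ys) ≤ maxL (map f xs) ∸ minL (map f xs) + 2
      bound []      _     _      = z≤n
      bound (a ∷ r) ys↭xs sorted = close (gap-chain-bound a r (sorted⇒gaps sorted distinct inside))
        where
        inside : All (_∈ xs) (a ∷ r)
        inside = All.tabulate (∈-resp-↭ ys↭xs)
        distinct : Unique (a ∷ r)
        distinct = Permutationₛ.Unique-resp-↭ (setoid A) (↭⇒↭ₛ (↭-sym ys↭xs)) unique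
        fa∈ : f a ∈ map f xs
        fa∈ = ∈-map⁺ f (All.lookup inside (here refl))
        min≤max : minL (map f xs) ≤ maxL (map f xs)
        min≤max = ≤-trans (minL-≤ fa∈) (maxL-≥ fa∈)
        X : ℕ
        X = length r * g + 2 * sum (map w (a ∷ r))
        close : ∃[ z ] z ∈ a ∷ r × f a + X ≤ f z + w a + w z → X ≤ maxL (map f xs) ∸ minL (map f xs) + 2
        close (z , z∈ , chain) = ≤-trans (m+n≤o⇒m≤o∸n X X+min≤max+2) (≤-reflexive (+-∸-comm 2 min≤max))
          where
          X+min≤max+2 : X + minL (map f xs) ≤ maxL (map f xs) + 2
          X+min≤max+2 = begin
            X + minL (map f xs)      ≤⟨ +-monoʳ-≤ X (minL-≤ fa∈) ⟩
            X + f a                  ≡⟨ +-comm X (f a) ⟩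
            f a + X                  ≤⟨ chain ⟩
            f z + w a + w z          ≡⟨ +-assoc (f z) (w a) (w z) ⟩
            f z + (w a + w z)        ≤⟨ +-mono-≤ (maxL-≥ (∈-map⁺ f (All.lookup inside z∈))) (+-mono-≤ (w≤1 a) (w≤1 z)) ⟩
            maxL (map f xs) + 2      ∎

centre : ∀ {m} → Fin m → ℕ
centre a = if isCenter a then 1 else 0

centre≤1 : ∀ {m} (a : Fin m) → centre a ≤ 1
centre≤1 zero    = ≤-refl
centre≤1 (suc _) = z≤n

dStar≤2 : ∀ {m} (a b : Fin m) → dStar a b ≤ 2
dStar≤2 a b with a ≟ᶠ b
... | yes _ = z≤n
... | no _  with isCenter a ∨ isCenter b
...   | true  = s≤s z≤n
...   | false = ≤-refl

dStar+centres≤2 : ∀ {m} (a b : Fin m) → dStar a b + (centre a + centre b) ≤ 2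
dStar+centres≤2 zero    zero    = ≤-refl
dStar+centres≤2 zero    (suc b) = ≤-refl
dStar+centres≤2 (suc a) zero    = ≤-refl
dStar+centres≤2 (suc a) (suc b) = ≤-trans (≤-reflexive (+-identityʳ _)) (dStar≤2 (suc a) (suc b))

-- G'' m n t unfolds to starCopies m t ((n ∸ 1) / 2).
starCopies : (m t k : ℕ) → List (Vtx m)
starCopies m t k = starCopy m t ++ starCopy m (t + k)

∈-starCopy⇒level : ∀ {m i u} → u ∈ starCopy m i → proj₂ u ≡ i
∈-starCopy⇒level p with ∈-map⁻ _ p
... | _ , _ , refl = refl

∈-starCopies⇒level : ∀ {m t k u} → u ∈ starCopies m t k → proj₂ u ≡ t ⊎ proj₂ u ≡ t + k
∈-starCopies⇒level {m} {t} p = Sum.map ∈-starCopy⇒level ∈-starCopy⇒level (∈-++⁻ (starCopy m t) p)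

∣levels∣≤ : ∀ {t k i j} → i ≡ t ⊎ i ≡ t + k → j ≡ t ⊎ j ≡ t + k → ∣ i - j ∣ ≤ k
∣levels∣≤ {t}     (inj₁ refl) (inj₁ refl) = ≤-trans (≤-reflexive (∣n-n∣≡0 t)) z≤n
∣levels∣≤ {t} {k} (inj₁ refl) (inj₂ refl) = ≤-reflexive (∣m-m+n∣≡n t k)
∣levels∣≤ {t} {k} (inj₂ refl) (inj₁ refl) = ≤-reflexive (trans (∣-∣-comm (t + k) t) (∣m-m+n∣≡n t k))
∣levels∣≤ {t} {k} (inj₂ refl) (inj₂ refl) = ≤-trans (≤-reflexive (∣n-n∣≡0 (t + k))) z≤n

dist+centres≤ : ∀ {m t k} {u v : Vtx m} → u ∈ starCopies m t k → v ∈ starCopies m t k →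
  dist u v + (centre (proj₁ u) + centre (proj₁ v)) ≤ k + 2
dist+centres≤ {k = k} {a , i} {b , j} u∈ v∈ = begin
  dStar a b + ∣ i - j ∣ + (centre a + centre b)   ≡⟨ arith (dStar a b) (∣ i - j ∣) (centre a + centre b) ⟩
  ∣ i - j ∣ + (dStar a b + (centre a + centre b)) ≤⟨ +-mono-≤ (∣levels∣≤ (∈-starCopies⇒level u∈) (∈-starCopies⇒level v∈))
                                                                (dStar+centres≤2 a b) ⟩
  k + 2                                           ∎
  where
  open ≤-Reasoning
  arith : ∀ x y z → x + y + z ≡ y + (x + z)
  arith = solve-∀

radio⇒separated : ∀ {m n t k} {f : Vtx m → ℕ} → n ≡ suc (k * 2) → IsRadioLabeling m n (starCopies m t k) f →
  ∀ {u v} → u ∈ starCopies m t k → v ∈ starCopies m t k → u ≢ v →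
  suc k + centre (proj₁ u) + centre (proj₁ v) ≤ ∣ f u - f v ∣
radio⇒separated {n = n} {k = k} {f} refl radio {u} {v} u∈ v∈ u≢v = +-cancelʳ-≤ (k + 2) _ _ (begin
  suc k + cᵤ + cᵥ + (k + 2)           ≡⟨ arith₁ k cᵤ cᵥ ⟩
  diam n + 1 + (cᵤ + cᵥ)              ≤⟨ +-monoˡ-≤ (cᵤ + cᵥ) (radio u v u∈ v∈ u≢v) ⟩
  dist u v + ∣ f u - f v ∣ + (cᵤ + cᵥ) ≡⟨ arith₂ (dist u v) (∣ f u - f v ∣) (cᵤ + cᵥ) ⟩
  dist u v + (cᵤ + cᵥ) + ∣ f u - f v ∣ ≤⟨ +-monoˡ-≤ ∣ f u - f v ∣ (dist+centres≤ u∈ v∈) ⟩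
  k + 2 + ∣ f u - f v ∣               ≡⟨ +-comm (k + 2) ∣ f u - f v ∣ ⟩
  ∣ f u - f v ∣ + (k + 2)             ∎)
  where
  open ≤-Reasoning
  cᵤ cᵥ : ℕ
  cᵤ = centre (proj₁ u)
  cᵥ = centre (proj₁ v)
  arith₁ : ∀ k x y → suc k + x + y + (k + 2) ≡ suc (k * 2) + 1 + 1 + (x + y)
  arith₁ = solve-∀
  arith₂ : ∀ x y z → x + y + z ≡ x + z + y
  arith₂ = solve-∀

unique-starCopies : ∀ m t j → Unique (starCopies m t (suc j))
unique-starCopies m t j = Unique.++⁺ copy copy disjoint
  where
  copy : ∀ {i} → Unique (starCopy m i)
  copy = Unique.map⁺ (cong proj₁) (Unique.allFin⁺ m)
  disjoint : ∀ {u} → ¬ (u ∈ starCopy m t × u ∈ starCopy m (t + suc j))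
  disjoint (p , q) = m+1+n≢m t (trans (sym (∈-starCopy⇒level q)) (∈-starCopy⇒level p))

length-starCopies : ∀ m t k → length (starCopies m t k) ≡ m + m
length-starCopies m t k = trans (length-++ (starCopy m t)) (cong₂ _+_ (length-starCopy t) (length-starCopy (t + k)))
  where
  length-starCopy : ∀ i → length (starCopy m i) ≡ m
  length-starCopy i = trans (length-map _ (allFin m)) (length-tabulate id)

sum-centres-starCopy : ∀ m i → sum (map (centre ∘ proj₁) (starCopy (suc m) i)) ≡ 1
sum-centres-starCopy m i = begin
  sum (map (centre ∘ proj₁) (map (_, i) (allFin (suc m)))) ≡⟨ cong sum (map-∘ {g = centre ∘ proj₁} {f = _, i} (allFin (suc m))) ⟨
  sum (map centre (allFin (suc m)))                        ≡⟨ cong sum (map-tabulate {n = suc m} id centre) ⟩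
  1 + sum (tabulate {n = m} (λ _ → 0))                     ≡⟨ cong suc (sum-zeros m) ⟩
  1                                                         ∎
  where
  open ≡-Reasoning
  sum-zeros : ∀ n → sum (tabulate {n = n} (λ _ → 0)) ≡ 0
  sum-zeros zero    = refl
  sum-zeros (suc n) = sum-zeros n

sum-centres-starCopies : ∀ m t k → sum (map (centre ∘ proj₁) (starCopies (suc m) t k)) ≡ 2
sum-centres-starCopies m t k = begin
  sum (map (centre ∘ proj₁) (starCopy (suc m) t ++ starCopy (suc m) (t + k)))
    ≡⟨ cong sum (map-++ (centre ∘ proj₁) (starCopy (suc m) t) _) ⟩
  sum (map (centre ∘ proj₁) (starCopy (suc m) t) ++ map (centre ∘ proj₁) (starCopy (suc m) (t + k)))
    ≡⟨ sum-++ (map (centre ∘ proj₁) (starCopy (suc m) t)) _ ⟩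
  sum (map (centre ∘ proj₁) (starCopy (suc m) t)) + sum (map (centre ∘ proj₁) (starCopy (suc m) (t + k)))
    ≡⟨ cong₂ _+_ (sum-centres-starCopy m t) (sum-centres-starCopy m (t + k)) ⟩
  2 ∎
  where open ≡-Reasoning

span-bound-arithmetic : ∀ m j → suc m * suc (suc j * 2) + suc m ∸ j + 2 ≡ (m + suc m) * suc (suc j) + 2 * 2
span-bound-arithmetic m j = begin
  suc m * suc (suc j * 2) + suc m ∸ j + 2     ≡⟨ cong (λ x → x ∸ j + 2) (expand m j) ⟩
  (m + suc m) * suc (suc j) + 2 + j ∸ j + 2   ≡⟨ cong (_+ 2) (m+n∸n≡m _ j) ⟩
  (m + suc m) * suc (suc j) + 2 + 2           ≡⟨ +-assoc _ 2 2 ⟩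
  (m + suc m) * suc (suc j) + 2 * 2           ∎
  where
  open ≡-Reasoning
  expand : ∀ m j → suc m * suc (suc j * 2) + suc m ≡ (m + suc m) * suc (suc j) + 2 + j
  expand = solve-∀

rn-starCopies : ∀ m k n t → 1 ≤ m → 1 ≤ k → n ≡ suc (k * 2) →
  rnAtLeast m n (starCopies m t k) (m * n + m ∸ pred k)
rn-starCopies (suc m) (suc j) n t _ _ refl f radio = +-cancelʳ-≤ 2 _ _ (begin
  suc m * n + suc m ∸ j + 2
    ≡⟨ span-bound-arithmetic m j ⟩
  (m + suc m) * suc (suc j) + 2 * 2
    ≡⟨ cong₂ (λ l s → (l ∸ 1) * suc (suc j) + 2 * s)
             (length-starCopies (suc m) t (suc j)) (sum-centres-starCopies m t (suc j)) ⟨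
  (length H ∸ 1) * suc (suc j) + 2 * sum (map (centre ∘ proj₁) H)
    ≤⟨ span-lower-bound f (centre ∘ proj₁) (suc (suc j)) (radio⇒separated {f = f} refl radio)
                         (centre≤1 ∘ proj₁) (unique-starCopies (suc m) t j) ⟩
  span H f + 2 ∎)
  where
  open ≤-Reasoning
  H : List (Vtx (suc m))
  H = starCopies (suc m) t (suc j)

[n∸3]/2≡pred[[n∸1]/2] : ∀ n → (n ∸ 3) / 2 ≡ pred ((n ∸ 1) / 2)
[n∸3]/2≡pred[[n∸1]/2] n = trans (cong (_/ 2) (sym (∸-+-assoc n 1 2))) ([m∸n]/n≡m/n∸1 (n ∸ 1) 2)

odd⇒≡1+[n∸1]/2*2 : ∀ {n} → n % 2 ≡ 1 → n ≡ suc ((n ∸ 1) / 2 * 2)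
odd⇒≡1+[n∸1]/2*2 {n} odd = trans n≡ (cong (λ h → suc (h * 2)) (sym half≡))
  where
  n≡ : n ≡ suc (n / 2 * 2)
  n≡ = trans (m≡m%n+[m/n]*n n 2) (cong (_+ n / 2 * 2) odd)
  half≡ : (n ∸ 1) / 2 ≡ n / 2
  half≡ = trans (cong (λ x → (x ∸ 1) / 2) n≡) (m*n/n≡m (n / 2) 2)

-- 5 ≤ n already follows from 2 ≤ t ≤ (n-1)/2, and of 4 ≤ m only m ≥ 1 is needed.
lemma3 : (m n t : ℕ) → 4 ≤ m → 5 ≤ n → n % 2 ≡ 1 → 2 ≤ t → t ≤ (n ∸ 1) / 2 →
    rnAtLeast m n (G'' m n t) (m * n + m ∸ (n ∸ 3) / 2)
lemma3 m n t 4≤m _ odd 2≤t t≤k =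
  subst (rnAtLeast m n (G'' m n t)) (cong (m * n + m ∸_) (sym ([n∸3]/2≡pred[[n∸1]/2] n)))
    (rn-starCopies m ((n ∸ 1) / 2) n t (≤-trans (s≤s z≤n) 4≤m) (≤-trans (s≤s z≤n) (≤-trans 2≤t t≤k))
      (odd⇒≡1+[n∸1]/2*2 odd))
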